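{- Let $D$ be a delta-matroid on $[n,\overline n]$ and write $U_D(u,0)=a_n+a_{n-1}u+\dots+a_0u^n$. Then $(a_0,\dots,a_n)$ is the $f$-vector of a pure simplicial complex. In particular, $a_i\le a_{n-i}$ for $i\le n/2$, and $a_0\le a_1\le\dots\le a_{\lfloor (n+1)/2\rfloor}$.
   Context: Let $[n,\overline{n}]=\{1,\dots,n,\overline{1},\dots,\overline{n}\}$ with involution $a\mapsto\overline a$; $\overline S=\{\overline a:a\in S\}$. Admissible sets contain at most one of $i,\overline i$ for each $i$; $\operatorname{AdS}_n$ is their set. A delta-matroid on $[n,\overline n]$ is a non-empty collection $\mathcal F$ of admissible sets of size $n$ (feasible sets) such that $\operatorname{Conv}\{e_B:B\in\mathcal F\}$ has all edges parallel to some $e_i$ or $e_i\pm e_j$ ($e_{\overline i}=-e_i$, $e_S=\sum_{a\in S}e_a$); rank function $g_D(S)=\max_{B\in\mathcal F}(|S\cap B|-|\overline S\cap B|)$; $U_D(u,v)=\sum_{S\in\operatorname{AdS}_n}u^{n-|S|}v^{(|S|-g_D(S))/2}$ with $0^0=1$. The $f$-vector $(a_0,\dots,a_n)$ of a simplicial complex lists by $a_k$ the number of faces with $k$ elements. -}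

module Defs where

open import Data.Nat as ℕ using (ℕ; zero; suc; _∸_; _≡ᵇ_)
open import Data.Integer as ℤ using (ℤ; +_; -[1+_]; _⊔_; _<_)
open import Data.Bool using (Bool; true; false; _∧_; if_then_else_)
open import Data.Fin as F using (Fin)
open import Data.Bool as B using ()
open import Data.Empty using (⊥)
open import Data.Vec using (Vec; []; _∷_; lookup)
open import Data.List as List using (List; []; _∷_; _++_; filter; length; foldr; map; concatMap)
open import Data.Product using (Σ; ∃; _×_; _,_)
open import Data.Sum using (_⊎_)
open import Relation.Binary.PropositionalEquality using (_≡_; _≢_)
open import Relation.Nullary.Decidable using (does)
open import Data.Fin.Subset using (Subset; _⊆_; _⊂_; ∣_∣)

-- An admissible set S ⊆ [n, n̄] is encoded by a vector over Tri:
--   S[i] = pos  means  i ∈ S,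
--   S[i] = neg  means  ī ∈ S,
--   S[i] = out  means  neither i nor ī is in S.
-- (Admissibility = at most one of i, ī; this encoding is exactly AdS_n.)

data Tri : Set where
  out pos neg : Tri

AdS : ℕ → Set
AdS n = Vec Tri n

-- An admissible set of size n (a candidate feasible set) contains exactly one
-- of i, ī for each i:  B[i] = true means i ∈ B, B[i] = false means ī ∈ B.
Transversal : ℕ → Set
Transversal n = Vec Bool n

size : ∀ {n} → AdS n → ℕ
size []          = 0
size (out ∷ s)   = size s
size (pos ∷ s)   = suc (size s)
size (neg ∷ s)   = suc (size s)

-- |S ∩ B| - |S̄ ∩ B|   (as an integer)
pairing : ∀ {n} → AdS n → Transversal n → ℤ
pairing []        []          = + 0
pairing (out ∷ s) (b ∷ bs)    = pairing s bs
pairing (pos ∷ s) (true ∷ bs)  = + 1 ℤ.+ pairing s bs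
pairing (pos ∷ s) (false ∷ bs) = -[1+ 0 ] ℤ.+ pairing s bs
pairing (neg ∷ s) (true ∷ bs)  = -[1+ 0 ] ℤ.+ pairing s bs
pairing (neg ∷ s) (false ∷ bs) = + 1 ℤ.+ pairing s bs

allTransversals : (n : ℕ) → List (Transversal n)
allTransversals zero    = [] ∷ []
allTransversals (suc n) =
  map (true ∷_) (allTransversals n) ++ map (false ∷_) (allTransversals n)

allAdS : (n : ℕ) → List (AdS n)
allAdS zero    = [] ∷ []
allAdS (suc n) =
  map (out ∷_) (allAdS n) ++ map (pos ∷_) (allAdS n) ++ map (neg ∷_) (allAdS n)

allSubsets : (m : ℕ) → List (Subset m)
allSubsets = allTransversals

Family : ℕ → Set
Family n = Transversal n → Bool

-- e_B = Σ_{a∈B} e_a with e_ī = - e_i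
eVec : ∀ {n} → Transversal n → Fin n → ℤ
eVec B i = if lookup B i then + 1 else -[1+ 0 ]

dot : ∀ {n} → (Fin n → ℤ) → (Fin n → ℤ) → ℤ
dot {zero}  w v = + 0
dot {suc n} w v = w F.zero ℤ.* v F.zero ℤ.+ dot {n} (λ i → w (F.suc i)) (λ i → v (F.suc i))

-- [e_B, e_B'] is an edge of Conv{e_C : C ∈ F}: B ≠ B' are both feasible and some
-- (integer) linear functional w is maximised over the points e_C (C ∈ F)
-- exactly at e_B and e_B'.
IsEdge : ∀ {n} → Family n → Transversal n → Transversal n → Set
IsEdge {n} F B B' =
  F B ≡ true × F B' ≡ true × B ≢ B' ×
  Σ (Fin n → ℤ) λ w →
    dot w (eVec B) ≡ dot w (eVec B') ×
    (∀ C → F C ≡ true → C ≢ B → C ≢ B' → dot w (eVec C) < dot w (eVec B))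

unit : ∀ {n} → Fin n → Fin n → ℤ
unit i j = if does (i F.≟ j) then + 1 else + 0

Parallel : ∀ {n} → (Fin n → ℤ) → (Fin n → ℤ) → Set
Parallel {n} u v = Σ ℤ λ c → c ≢ + 0 × (∀ k → u k ≡ c ℤ.* v k)

AllowedDirection : ∀ {n} → (Fin n → ℤ) → Set
AllowedDirection {n} v =
  (Σ (Fin n) λ i → Parallel v (unit i))
  ⊎ (Σ (Fin n) λ i → Σ (Fin n) λ j → i ≢ j × Parallel v (λ k → unit i k ℤ.+ unit j k))
  ⊎ (Σ (Fin n) λ i → Σ (Fin n) λ j → i ≢ j × Parallel v (λ k → unit i k ℤ.- unit j k))

record DeltaMatroid (n : ℕ) : Set where
  field
    feasible  : Family n
    nonempty  : ∃ λ B → feasible B ≡ true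
    edges     : ∀ B B' → IsEdge feasible B B' →
                AllowedDirection (λ k → eVec B k ℤ.- eVec B' k)

open DeltaMatroid public

feasibleList : ∀ {n} → DeltaMatroid n → List (Transversal n)
feasibleList {n} D = filter (λ B → B._≟_ (feasible D B) true) (allTransversals n)

-- g_D(S) = max_{B ∈ F} (|S ∩ B| - |S̄ ∩ B|).  The fold starts below every
-- possible value (-n-1), so for the non-empty family it is the true maximum.
rank : ∀ {n} → DeltaMatroid n → AdS n → ℤ
rank {n} D S = foldr (λ B m → pairing S B ⊔ m) -[1+ n ] (feasibleList D)

-- A term u^{n-|S|} v^{(|S|-g_D(S))/2} contributes to U_D(u,0)
-- iff its v-exponent is 0 (0^0 = 1, 0^e = 0 for e > 0), i.e. iff |S| = g_D(S).

vExpZero : ∀ {n} → DeltaMatroid n → AdS n → Bool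
vExpZero D S = does (+ size S ℤ.≟ rank D S)

UD0coeff : ∀ {n} → DeltaMatroid n → ℕ → ℕ
UD0coeff {n} D m =
  length (filter (λ S → B._≟_ (vExpZero D S ∧ ((n ∸ size S) ≡ᵇ m)) true) (allAdS n))

-- Writing U_D(u,0) = a_n + a_{n-1} u + ... + a_0 u^n, a_k is the coefficient of u^{n-k}.
aCoeff : ∀ {n} → DeltaMatroid n → ℕ → ℕ
aCoeff {n} D k = UD0coeff D (n ∸ k)

record SimplicialComplex (m : ℕ) : Set where
  field
    face      : Subset m → Bool
    downClosed : ∀ σ τ → face σ ≡ true → τ ⊆ σ → face τ ≡ true

open SimplicialComplex public

IsFacet : ∀ {m} → SimplicialComplex m → Subset m → Set
IsFacet Δ σ = face Δ σ ≡ true × (∀ τ → face Δ τ ≡ true → σ ⊂ τ → ⊥)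

IsPure : ∀ {m} → SimplicialComplex m → Set
IsPure Δ = ∀ σ τ → IsFacet Δ σ → IsFacet Δ τ → ∣ σ ∣ ≡ ∣ τ ∣

fvec : ∀ {m} → SimplicialComplex m → ℕ → ℕ
fvec {m} Δ k =
  length (filter (λ σ → B._≟_ (face Δ σ ∧ (∣ σ ∣ ≡ᵇ k)) true) (allSubsets m))

IsFVectorOf : ∀ {m} → (n : ℕ) → (ℕ → ℕ) → SimplicialComplex m → Set
IsFVectorOf n a Δ = (∀ k → k ℕ.≤ n → fvec Δ k ≡ a k) × (∀ k → n ℕ.< k → fvec Δ k ≡ 0)

-- A term of U_D(u,0) survives iff |S| = g_D(S), i.e. iff S lies inside some feasible set, so
-- a_k counts the admissible k-sets contained in a feasible set.  Encoding i and ī as two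
-- vertices, these sets form a simplicial complex whose facets are the feasible sets, all of
-- size n.  For the inequalities, double count the pairs R ⊑ S of faces with |R| = i and
-- |S| = j: every i-face lies in at least C(n-i, j-i) faces of size j (those inside a feasible
-- set containing it), and every j-face contains at most C(j, i) faces of size i.  Hence
-- a_i C(n-i, j-i) ≤ a_j C(j, i) ≤ a_j C(n-i, j-i) whenever i ≤ j ≤ n - i.
module Submission where

open import Defs
open import Data.Nat using (ℕ; zero; suc; _+_; _*_; _∸_; _≤_; _<_; _≤′_; _≡ᵇ_; _≟_; _/_; z≤n; s≤s; ≤′-refl; ≤′-step; >-nonZero)
open import Data.Nat.Properties
open import Algebra.Properties.CommutativeSemigroup +-commutativeSemigroup using () renaming (interchange to +-interchange)
open import Data.Nat.Combinatorics using (_C_; nCk≡nC[n∸k]; nCk+nC[k+1]≡[n+1]C[k+1])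
open import Data.Nat.DivMod using (m/n*n≤m)
open import Data.Integer as ℤ using (ℤ; +_; _⊔_; +<+; -<+)
import Data.Integer.Properties as ℤ
open import Data.Bool as Bool using (Bool; true; false; _∧_; T; T?)
open import Data.Bool.Properties using (T-∧; T-≡)
open import Data.Vec using ([]; _∷_)
open import Data.List using (List; []; _∷_; _++_; map; filter; length; foldr)
open import Data.Bool.ListAction using (any)
open import Data.List.Membership.Propositional using (find; lose)
open import Data.List.Relation.Unary.Any as Any using (Any; here; there)
open import Data.List.Relation.Unary.Any.Properties using (any⁺; any⁻)
open import Data.Fin.Subset using (Subset; _⊆_; _⊂_; ∣_∣; inside; outside)
open import Data.Fin.Subset.Properties using (⊆-refl; drop-∷-⊆; s⊆s; out⊆; s⊂s; out⊂; out⊂in)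
import Data.Vec.Base as Vec
open import Data.Product using (Σ; _×_; _,_; proj₂)
open import Data.Sum using (inj₁; inj₂)
open import Data.Empty using (⊥-elim)
open import Function using (_∘_; _⇔_; mk⇔; Equivalence)
open import Relation.Binary.PropositionalEquality
open import Relation.Nullary using (¬_; yes; no; contradiction)
open import Relation.Nullary.Decidable using (does-⇔)

open Equivalence using (to; from)

private variable
  A A′ : Set
  n i j k : ℕ

¬T[x∧false] : ∀ x → ¬ T (x ∧ false)
¬T[x∧false] true  ()
¬T[x∧false] false ()

¬T[x∧[y∧false]] : ∀ x y → ¬ T (x ∧ (y ∧ false))
¬T[x∧[y∧false]] true  y = ¬T[x∧false] y
¬T[x∧[y∧false]] false y ()

𝟙 : Bool → ℕ
𝟙 true  = 1
𝟙 false = 0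

sumBy : (A → ℕ) → List A → ℕ
sumBy f []       = 0
sumBy f (x ∷ xs) = f x + sumBy f xs

count : (A → Bool) → List A → ℕ
count p = sumBy (λ x → 𝟙 (p x))

sumBy-++ : (f : A → ℕ) (xs ys : List A) → sumBy f (xs ++ ys) ≡ sumBy f xs + sumBy f ys
sumBy-++ f []       ys = refl
sumBy-++ f (x ∷ xs) ys = trans (cong (_+_ (f x)) (sumBy-++ f xs ys)) (sym (+-assoc (f x) _ _))

sumBy-map : (f : A′ → ℕ) (g : A → A′) (xs : List A) → sumBy f (map g xs) ≡ sumBy (f ∘ g) xs
sumBy-map f g []       = refl
sumBy-map f g (x ∷ xs) = cong (_+_ (f (g x))) (sumBy-map f g xs)

sumBy-cong : {f g : A → ℕ} (xs : List A) → (∀ x → f x ≡ g x) → sumBy f xs ≡ sumBy g xs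
sumBy-cong []       f≡g = refl
sumBy-cong (x ∷ xs) f≡g = cong₂ _+_ (f≡g x) (sumBy-cong xs f≡g)

sumBy-mono : {f g : A → ℕ} (xs : List A) → (∀ x → f x ≤ g x) → sumBy f xs ≤ sumBy g xs
sumBy-mono []       f≤g = z≤n
sumBy-mono (x ∷ xs) f≤g = +-mono-≤ (f≤g x) (sumBy-mono xs f≤g)

sumBy-zero : (xs : List A) → sumBy (λ _ → 0) xs ≡ 0
sumBy-zero []       = refl
sumBy-zero (x ∷ xs) = sumBy-zero xs

sumBy-+ : (f g : A → ℕ) (xs : List A) → sumBy (λ x → f x + g x) xs ≡ sumBy f xs + sumBy g xs
sumBy-+ f g []       = refl
sumBy-+ f g (x ∷ xs) =
  trans (cong (_+_ (f x + g x)) (sumBy-+ f g xs)) (+-interchange (f x) (g x) (sumBy f xs) (sumBy g xs))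

sumBy-swap : (f : A → A′ → ℕ) (xs : List A) (ys : List A′) →
             sumBy (λ x → sumBy (f x) ys) xs ≡ sumBy (λ y → sumBy (λ x → f x y) xs) ys
sumBy-swap f []       ys = sym (sumBy-zero ys)
sumBy-swap f (x ∷ xs) ys =
  trans (cong (_+_ (sumBy (f x) ys)) (sumBy-swap f xs ys)) (sym (sumBy-+ (f x) _ ys))

sumBy-*ʳ : (f : A → ℕ) (a : ℕ) (xs : List A) → sumBy f xs * a ≡ sumBy (λ x → f x * a) xs
sumBy-*ʳ f a []       = refl
sumBy-*ʳ f a (x ∷ xs) = trans (*-distribʳ-+ a (f x) _) (cong (_+_ (f x * a)) (sumBy-*ʳ f a xs))

count-cong : {p q : A → Bool} (xs : List A) → (∀ x → p x ≡ q x) → count p xs ≡ count q xs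
count-cong xs p≡q = sumBy-cong xs (cong 𝟙 ∘ p≡q)

count-mono : {p q : A → Bool} (xs : List A) → (∀ x → T (p x) → T (q x)) → count p xs ≤ count q xs
count-mono {p = p} {q} xs p⇒q = sumBy-mono xs 𝟙-mono
  where
  𝟙-mono : ∀ x → 𝟙 (p x) ≤ 𝟙 (q x)
  𝟙-mono x with p x | q x | p⇒q x
  ... | false | _     | _  = z≤n
  ... | true  | true  | _  = ≤-refl
  ... | true  | false | pq = ⊥-elim (pq _)

count-none : {p : A → Bool} (xs : List A) → (∀ x → ¬ T (p x)) → count p xs ≡ 0
count-none {p = p} xs ¬p = trans (sumBy-cong xs 𝟙≡0) (sumBy-zero xs)
  where
  𝟙≡0 : ∀ x → 𝟙 (p x) ≡ 0
  𝟙≡0 x with p x | ¬p x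
  ... | false | _  = refl
  ... | true  | ¬t = ⊥-elim (¬t _)

count-map-++ : (p : A′ → Bool) (f g : A → A′) (xs ys : List A) →
               count p (map f xs ++ map g ys) ≡ count (p ∘ f) xs + count (p ∘ g) ys
count-map-++ p f g xs ys =
  trans (sumBy-++ _ (map f xs) _) (cong₂ _+_ (sumBy-map _ f xs) (sumBy-map _ g ys))

length-filter≡count : (p : A → Bool) (xs : List A) →
                      length (filter (λ x → p x Bool.≟ true) xs) ≡ count p xs
length-filter≡count p []       = refl
length-filter≡count p (x ∷ xs) with p x
... | true  = cong suc (length-filter≡count p xs)
... | false = length-filter≡count p xs

double-counting : (p : A → Bool) (q : A′ → Bool) (R : A → A′ → Bool) (xs : List A) (ys : List A′) {a b : ℕ} →
                  (∀ x → T (p x) → a ≤ count (λ y → q y ∧ R x y) ys) →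
                  (∀ y → T (q y) → count (λ x → p x ∧ R x y) xs ≤ b) →
                  count p xs * a ≤ count q ys * b
double-counting p q R xs ys {a} {b} lower upper = begin
  count p xs * a                                       ≡⟨ sumBy-*ʳ _ a xs ⟩
  sumBy (λ x → 𝟙 (p x) * a) xs                          ≤⟨ sumBy-mono xs lower′ ⟩
  sumBy (λ x → sumBy (λ y → 𝟙 (pqR x y)) ys) xs         ≡⟨ sumBy-swap (λ x y → 𝟙 (pqR x y)) xs ys ⟩
  sumBy (λ y → sumBy (λ x → 𝟙 (pqR x y)) xs) ys         ≤⟨ sumBy-mono ys upper′ ⟩
  sumBy (λ y → 𝟙 (q y) * b) ys                          ≡⟨ sumBy-*ʳ _ b ys ⟨
  count q ys * b                                       ∎
  where
  open ≤-Reasoning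
  pqR : _ → _ → Bool
  pqR x y = p x ∧ (q y ∧ R x y)
  lower′ : ∀ x → 𝟙 (p x) * a ≤ count (pqR x) ys
  lower′ x with p x | lower x
  ... | true  | h = subst (_≤ _) (sym (+-identityʳ a)) (h _)
  ... | false | _ = z≤n
  upper′ : ∀ y → count (λ x → pqR x y) xs ≤ 𝟙 (q y) * b
  upper′ y with q y | upper y
  ... | true  | h = subst (_ ≤_) (sym (+-identityʳ b)) (h _)
  ... | false | _ = ≤-reflexive (count-none xs (λ x → ¬T[x∧false] (p x)))

C-positive : k ≤ n → 0 < n C k
C-positive {zero}  {n}     _         = s≤s z≤n
C-positive {suc k} {suc n} (s≤s k≤n) =
  subst (0 <_) (nCk+nC[k+1]≡[n+1]C[k+1] n k) (≤-trans (C-positive k≤n) (m≤m+n (n C k) (n C suc k)))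

C-monoˡ : ∀ {m} k → m ≤ n → m C k ≤ n C k
C-monoˡ k m≤n = go (≤⇒≤′ m≤n)
  where
  step : ∀ n k → n C k ≤ suc n C k
  step n zero    = ≤-refl
  step n (suc k) = subst (n C suc k ≤_) (nCk+nC[k+1]≡[n+1]C[k+1] n k) (m≤n+m (n C suc k) (n C k))
  go : ∀ {m n} → m ≤′ n → m C k ≤ n C k
  go ≤′-refl       = ≤-refl
  go (≤′-step m≤n) = ≤-trans (go m≤n) (step _ k)

_⊑ᵇ_ : AdS n → AdS n → Bool
[]        ⊑ᵇ []        = true
(out ∷ R) ⊑ᵇ (_   ∷ S) = R ⊑ᵇ S
(pos ∷ R) ⊑ᵇ (pos ∷ S) = R ⊑ᵇ S
(neg ∷ R) ⊑ᵇ (neg ∷ S) = R ⊑ᵇ S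
(pos ∷ R) ⊑ᵇ (_   ∷ S) = false
(neg ∷ R) ⊑ᵇ (_   ∷ S) = false

gap : AdS n → AdS n → ℕ
gap []        []        = 0
gap (out ∷ R) (out ∷ S) = gap R S
gap (out ∷ R) (_   ∷ S) = suc (gap R S)
gap (_   ∷ R) (_   ∷ S) = gap R S

∅ : AdS n
∅ {zero}  = []
∅ {suc n} = out ∷ ∅

toAdS : Transversal n → AdS n
toAdS []          = []
toAdS (true ∷ B)  = pos ∷ toAdS B
toAdS (false ∷ B) = neg ∷ toAdS B

⊑ᵇ-refl : (S : AdS n) → T (S ⊑ᵇ S)
⊑ᵇ-refl []        = _
⊑ᵇ-refl (out ∷ S) = ⊑ᵇ-refl S
⊑ᵇ-refl (pos ∷ S) = ⊑ᵇ-refl S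
⊑ᵇ-refl (neg ∷ S) = ⊑ᵇ-refl S

⊑ᵇ-trans : {R S U : AdS n} → T (R ⊑ᵇ S) → T (S ⊑ᵇ U) → T (R ⊑ᵇ U)
⊑ᵇ-trans {R = []}      {[]}      {[]}      _   _   = _
⊑ᵇ-trans {R = out ∷ R} {out ∷ S} {_ ∷ U}   R⊑S S⊑U = ⊑ᵇ-trans {R = R} R⊑S S⊑U
⊑ᵇ-trans {R = out ∷ R} {pos ∷ S} {pos ∷ U} R⊑S S⊑U = ⊑ᵇ-trans {R = R} R⊑S S⊑U
⊑ᵇ-trans {R = out ∷ R} {neg ∷ S} {neg ∷ U} R⊑S S⊑U = ⊑ᵇ-trans {R = R} R⊑S S⊑U
⊑ᵇ-trans {R = pos ∷ R} {pos ∷ S} {pos ∷ U} R⊑S S⊑U = ⊑ᵇ-trans {R = R} R⊑S S⊑U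
⊑ᵇ-trans {R = neg ∷ R} {neg ∷ S} {neg ∷ U} R⊑S S⊑U = ⊑ᵇ-trans {R = R} R⊑S S⊑U

∅⊑ᵇ : (S : AdS n) → T (∅ ⊑ᵇ S)
∅⊑ᵇ []      = _
∅⊑ᵇ (_ ∷ S) = ∅⊑ᵇ S

gap-∅ : (S : AdS n) → gap ∅ S ≡ size S
gap-∅ []        = refl
gap-∅ (out ∷ S) = gap-∅ S
gap-∅ (pos ∷ S) = cong suc (gap-∅ S)
gap-∅ (neg ∷ S) = cong suc (gap-∅ S)

size-⊑ᵇ : (R S : AdS n) → T (R ⊑ᵇ S) → size S ≡ size R + gap R S
size-⊑ᵇ [] []      _   = refl
size-⊑ᵇ (out ∷ R) (out ∷ S) R⊑S = size-⊑ᵇ R S R⊑S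
size-⊑ᵇ (out ∷ R) (pos ∷ S) R⊑S = trans (cong suc (size-⊑ᵇ R S R⊑S)) (sym (+-suc (size R) _))
size-⊑ᵇ (out ∷ R) (neg ∷ S) R⊑S = trans (cong suc (size-⊑ᵇ R S R⊑S)) (sym (+-suc (size R) _))
size-⊑ᵇ (pos ∷ R) (pos ∷ S) R⊑S = cong suc (size-⊑ᵇ R S R⊑S)
size-⊑ᵇ (neg ∷ R) (neg ∷ S) R⊑S = cong suc (size-⊑ᵇ R S R⊑S)

size≤n : (S : AdS n) → size S ≤ n
size≤n []        = z≤n
size≤n (out ∷ S) = m≤n⇒m≤1+n (size≤n S)
size≤n (pos ∷ S) = s≤s (size≤n S)
size≤n (neg ∷ S) = s≤s (size≤n S)

size-toAdS : (B : Transversal n) → size (toAdS B) ≡ n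
size-toAdS []          = refl
size-toAdS (true ∷ B)  = cong suc (size-toAdS B)
size-toAdS (false ∷ B) = cong suc (size-toAdS B)

count-allAdS : (p : AdS (suc n) → Bool) →
  count p (allAdS (suc n)) ≡
    count (λ S → p (out ∷ S)) (allAdS n) + (count (λ S → p (pos ∷ S)) (allAdS n) + count (λ S → p (neg ∷ S)) (allAdS n))
count-allAdS {n} p =
  trans (sumBy-++ _ (map (out ∷_) (allAdS n)) _)
        (cong₂ _+_ (sumBy-map _ _ (allAdS n)) (count-map-++ p (pos ∷_) (neg ∷_) (allAdS n) (allAdS n)))

count-allTransversals : (p : Transversal (suc n) → Bool) →
  count p (allTransversals (suc n)) ≡
    count (λ B → p (true ∷ B)) (allTransversals n) + count (λ B → p (false ∷ B)) (allTransversals n)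
count-allTransversals {n} p = count-map-++ p (true ∷_) (false ∷_) (allTransversals n) (allTransversals n)

between : AdS n → AdS n → ℕ → AdS n → Bool
between R U j S = R ⊑ᵇ S ∧ (S ⊑ᵇ U ∧ (gap R S ≡ᵇ j))

C-pascal : ∀ g j → g C suc j + g C j ≡ suc g C suc j
C-pascal g j = trans (+-comm (g C suc j) (g C j)) (nCk+nC[k+1]≡[n+1]C[k+1] g j)

count-⊑ᵇ∧false : (R : AdS n) → count (λ S → R ⊑ᵇ S ∧ false) (allAdS n) ≡ 0
count-⊑ᵇ∧false R = count-none (allAdS _) λ S → ¬T[x∧false] (R ⊑ᵇ S)

count-⊑ᵇ∧⊑ᵇ∧false : (R U : AdS n) → count (λ S → R ⊑ᵇ S ∧ (S ⊑ᵇ U ∧ false)) (allAdS n) ≡ 0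
count-⊑ᵇ∧⊑ᵇ∧false R U = count-none (allAdS _) λ S → ¬T[x∧[y∧false]] (R ⊑ᵇ S) (S ⊑ᵇ U)

count-false : (n : ℕ) → count (λ (S : AdS n) → false) (allAdS n) ≡ 0
count-false n = count-none (allAdS n) λ _ ()

count-between : (R U : AdS n) (j : ℕ) → T (R ⊑ᵇ U) → count (between R U j) (allAdS n) ≡ gap R U C j
count-between [] [] zero    _ = refl
count-between [] [] (suc j) _ = refl
count-between (out ∷ R) (out ∷ U) j R⊑U =
  trans (count-allAdS (between (out ∷ R) (out ∷ U) j))
        (trans (cong₂ _+_ (count-between R U j R⊑U) (cong₂ _+_ (count-⊑ᵇ∧false R) (count-⊑ᵇ∧false R)))
               (+-identityʳ _))
count-between (out ∷ R) (pos ∷ U) zero R⊑U =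
  trans (count-allAdS (between (out ∷ R) (pos ∷ U) zero))
        (cong₂ _+_ (count-between R U 0 R⊑U) (cong₂ _+_ (count-⊑ᵇ∧⊑ᵇ∧false R U) (count-⊑ᵇ∧false R)))
count-between (out ∷ R) (pos ∷ U) (suc j) R⊑U =
  trans (count-allAdS (between (out ∷ R) (pos ∷ U) (suc j)))
        (trans (cong₂ _+_ (count-between R U (suc j) R⊑U) (cong₂ _+_ (count-between R U j R⊑U) (count-⊑ᵇ∧false R)))
               (trans (cong (_+_ (gap R U C suc j)) (+-identityʳ _)) (C-pascal (gap R U) j)))
count-between (out ∷ R) (neg ∷ U) zero R⊑U =
  trans (count-allAdS (between (out ∷ R) (neg ∷ U) zero))
        (cong₂ _+_ (count-between R U 0 R⊑U) (cong₂ _+_ (count-⊑ᵇ∧false R) (count-⊑ᵇ∧⊑ᵇ∧false R U)))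
count-between (out ∷ R) (neg ∷ U) (suc j) R⊑U =
  trans (count-allAdS (between (out ∷ R) (neg ∷ U) (suc j)))
        (trans (cong₂ _+_ (count-between R U (suc j) R⊑U) (cong₂ _+_ (count-⊑ᵇ∧false R) (count-between R U j R⊑U)))
               (C-pascal (gap R U) j))
count-between {suc n} (pos ∷ R) (pos ∷ U) j R⊑U =
  trans (count-allAdS (between (pos ∷ R) (pos ∷ U) j))
        (trans (cong₂ _+_ (count-false n) (cong₂ _+_ (count-between R U j R⊑U) (count-false n))) (+-identityʳ _))
count-between {suc n} (neg ∷ R) (neg ∷ U) j R⊑U =
  trans (count-allAdS (between (neg ∷ R) (neg ∷ U) j))
        (cong₂ _+_ (count-false n) (cong₂ _+_ (count-false n) (count-between R U j R⊑U)))

i≤s⇒pred[i]<1+s : ∀ {i s} → i ℤ.≤ + s → ℤ.pred i ℤ.< + suc s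
i≤s⇒pred[i]<1+s i≤s = ℤ.<-trans (ℤ.i≤pred[j]⇒i<j (ℤ.pred-mono i≤s)) (+<+ (n<1+n _))

pairing≤size : (S : AdS n) (B : Transversal n) → pairing S B ℤ.≤ + size S
pairing≤size []        []          = ℤ.≤-refl
pairing≤size (out ∷ S) (_ ∷ B)     = pairing≤size S B
pairing≤size (pos ∷ S) (true ∷ B)  = ℤ.+-monoʳ-≤ (+ 1) (pairing≤size S B)
pairing≤size (pos ∷ S) (false ∷ B) = ℤ.<⇒≤ (i≤s⇒pred[i]<1+s (pairing≤size S B))
pairing≤size (neg ∷ S) (true ∷ B)  = ℤ.<⇒≤ (i≤s⇒pred[i]<1+s (pairing≤size S B))
pairing≤size (neg ∷ S) (false ∷ B) = ℤ.+-monoʳ-≤ (+ 1) (pairing≤size S B)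

pairing<size : (S : AdS n) (B : Transversal n) → ¬ T (S ⊑ᵇ toAdS B) → pairing S B ℤ.< + size S
pairing<size (out ∷ S) (true ∷ B)  S⋢B = pairing<size S B S⋢B
pairing<size (out ∷ S) (false ∷ B) S⋢B = pairing<size S B S⋢B
pairing<size (pos ∷ S) (true ∷ B)  S⋢B = ℤ.+-monoʳ-< (+ 1) (pairing<size S B S⋢B)
pairing<size (pos ∷ S) (false ∷ B) _   = i≤s⇒pred[i]<1+s (pairing≤size S B)
pairing<size (neg ∷ S) (true ∷ B)  _   = i≤s⇒pred[i]<1+s (pairing≤size S B)
pairing<size (neg ∷ S) (false ∷ B) S⋢B = ℤ.+-monoʳ-< (+ 1) (pairing<size S B S⋢B)
pairing<size []        []          S⋢B = contradiction _ S⋢B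

pairing≡size : (S : AdS n) (B : Transversal n) → T (S ⊑ᵇ toAdS B) → pairing S B ≡ + size S
pairing≡size []        []          _   = refl
pairing≡size (out ∷ S) (true ∷ B)  S⊑B = pairing≡size S B S⊑B
pairing≡size (out ∷ S) (false ∷ B) S⊑B = pairing≡size S B S⊑B
pairing≡size (pos ∷ S) (true ∷ B)  S⊑B = cong ℤ.suc (pairing≡size S B S⊑B)
pairing≡size (neg ∷ S) (false ∷ B) S⊑B = cong ℤ.suc (pairing≡size S B S⊑B)

pairing≡size⇔⊑ᵇ : (S : AdS n) (B : Transversal n) → pairing S B ≡ + size S ⇔ T (S ⊑ᵇ toAdS B)
pairing≡size⇔⊑ᵇ S B = mk⇔ attained (pairing≡size S B)
  where
  attained : pairing S B ≡ + size S → T (S ⊑ᵇ toAdS B)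
  attained p≡s with T? (S ⊑ᵇ toAdS B)
  ... | yes S⊑B = S⊑B
  ... | no  S⋢B = contradiction p≡s (ℤ.<⇒≢ (pairing<size S B S⋢B))

foldr-⊔-bounded : (f : A → ℤ) {b c : ℤ} → b ℤ.≤ c → (∀ x → f x ℤ.≤ c) →
                  (xs : List A) → foldr (λ x m → f x ⊔ m) b xs ℤ.≤ c
foldr-⊔-bounded f b≤c f≤c []       = b≤c
foldr-⊔-bounded f b≤c f≤c (x ∷ xs) = ℤ.⊔-lub (f≤c x) (foldr-⊔-bounded f b≤c f≤c xs)

foldr-⊔≡⇔ : (f : A → ℤ) {b c : ℤ} → b ℤ.< c → (∀ x → f x ℤ.≤ c) →
            (xs : List A) → foldr (λ x m → f x ⊔ m) b xs ≡ c ⇔ Any (λ x → f x ≡ c) xs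
foldr-⊔≡⇔ f {b} {c} b<c f≤c xs = mk⇔ (reached xs) (attained xs)
  where
  reached : ∀ xs → foldr (λ x m → f x ⊔ m) b xs ≡ c → Any (λ x → f x ≡ c) xs
  reached []       b≡c = contradiction b≡c (ℤ.<⇒≢ b<c)
  reached (x ∷ xs) m≡c with ℤ.⊔-sel (f x) (foldr (λ x m → f x ⊔ m) b xs)
  ... | inj₁ m≡fx = here (trans (sym m≡fx) m≡c)
  ... | inj₂ m≡r  = there (reached xs (trans (sym m≡r) m≡c))
  attained : ∀ xs → Any (λ x → f x ≡ c) xs → foldr (λ x m → f x ⊔ m) b xs ≡ c
  attained (x ∷ xs) (here fx≡c) =
    trans (ℤ.i≥j⇒i⊔j≡i (subst (_ ℤ.≤_) (sym fx≡c) (foldr-⊔-bounded f (ℤ.<⇒≤ b<c) f≤c xs))) fx≡c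
  attained (x ∷ xs) (there p) = trans (cong (f x ⊔_) (attained xs p)) (ℤ.i≤j⇒i⊔j≡j (f≤c x))

independent : DeltaMatroid n → AdS n → Bool
independent D S = any (λ B → S ⊑ᵇ toAdS B) (feasibleList D)

size≡rank⇔independent : (D : DeltaMatroid n) (S : AdS n) → + size S ≡ rank D S ⇔ T (independent D S)
size≡rank⇔independent D S = mk⇔
  (λ s≡r → any⁺ S⊑ (Any.map (to (pairing≡size⇔⊑ᵇ S _)) (to max≡size⇔ (sym s≡r))))
  (λ S-ind → sym (from max≡size⇔ (Any.map (from (pairing≡size⇔⊑ᵇ S _)) (any⁻ S⊑ _ S-ind))))
  where
  S⊑ : Transversal _ → Bool
  S⊑ B = S ⊑ᵇ toAdS B
  max≡size⇔ = foldr-⊔≡⇔ (pairing S) -<+ (pairing≤size S) (feasibleList D)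

vExpZero≡independent : (D : DeltaMatroid n) (S : AdS n) → vExpZero D S ≡ independent D S
-- does (T? b) reduces to b.
vExpZero≡independent D S =
  does-⇔ (size≡rank⇔independent D S) (+ size S ℤ.≟ rank D S) (T? (independent D S))

independent-down : (D : DeltaMatroid n) {R S : AdS n} → T (R ⊑ᵇ S) → T (independent D S) → T (independent D R)
independent-down D {R} {S} R⊑S =
  any⁺ (λ B → R ⊑ᵇ toAdS B)
  ∘ Any.map (λ {B} → ⊑ᵇ-trans {R = R} {S} {toAdS B} R⊑S)
  ∘ any⁻ (λ B → S ⊑ᵇ toAdS B) (feasibleList D)

independent-extends : (D : DeltaMatroid n) {S : AdS n} → T (independent D S) →
                      Σ (AdS n) λ U → T (independent D U) × size U ≡ n × T (S ⊑ᵇ U)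
independent-extends D {S} S-ind with find (any⁻ (λ B → S ⊑ᵇ toAdS B) (feasibleList D) S-ind)
... | B , B∈ , S⊑B =
  toAdS B , any⁺ (λ B′ → toAdS B ⊑ᵇ toAdS B′) (lose B∈ (⊑ᵇ-refl (toAdS B))) , size-toAdS B , S⊑B

-- Vertices 2i and 2i+1 of Fin (dbl n) stand for i and ī.
dbl : ℕ → ℕ
dbl zero    = 0
dbl (suc n) = suc (suc (dbl n))

admissible : Subset (dbl n) → Bool
admissible {zero}  []                 = true
admissible {suc n} (true ∷ true ∷ σ)  = false
admissible {suc n} (true ∷ false ∷ σ) = admissible σ
admissible {suc n} (false ∷ _ ∷ σ)    = admissible σ

decode : Subset (dbl n) → AdS n
decode {zero}  []                  = []
decode {suc n} (true ∷ _ ∷ σ)      = pos ∷ decode σ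
decode {suc n} (false ∷ true ∷ σ)  = neg ∷ decode σ
decode {suc n} (false ∷ false ∷ σ) = out ∷ decode σ

encode : AdS n → Subset (dbl n)
encode []        = []
encode (out ∷ S) = false ∷ false ∷ encode S
encode (pos ∷ S) = true ∷ false ∷ encode S
encode (neg ∷ S) = false ∷ true ∷ encode S

admissible-encode : (S : AdS n) → T (admissible (encode S))
admissible-encode []        = _
admissible-encode (out ∷ S) = admissible-encode S
admissible-encode (pos ∷ S) = admissible-encode S
admissible-encode (neg ∷ S) = admissible-encode S

decode-encode : (S : AdS n) → decode (encode S) ≡ S
decode-encode []        = refl
decode-encode (out ∷ S) = cong (out ∷_) (decode-encode S)
decode-encode (pos ∷ S) = cong (pos ∷_) (decode-encode S)
decode-encode (neg ∷ S) = cong (neg ∷_) (decode-encode S)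

∣encode∣ : (S : AdS n) → ∣ encode S ∣ ≡ size S
∣encode∣ []        = refl
∣encode∣ (out ∷ S) = ∣encode∣ S
∣encode∣ (pos ∷ S) = cong suc (∣encode∣ S)
∣encode∣ (neg ∷ S) = cong suc (∣encode∣ S)

∣σ∣≡size-decode : (σ : Subset (dbl n)) → T (admissible σ) → ∣ σ ∣ ≡ size (decode σ)
∣σ∣≡size-decode {zero}  []                  _ = refl
∣σ∣≡size-decode {suc n} (true ∷ false ∷ σ)  a = cong suc (∣σ∣≡size-decode σ a)
∣σ∣≡size-decode {suc n} (false ∷ true ∷ σ)  a = cong suc (∣σ∣≡size-decode σ a)
∣σ∣≡size-decode {suc n} (false ∷ false ∷ σ) a = ∣σ∣≡size-decode σ a

inside∷⊈outside∷ : ∀ {m} {p q : Subset m} → ¬ (inside ∷ p ⊆ outside ∷ q)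
inside∷⊈outside∷ p⊆q with p⊆q Vec.here
... | ()

p⊆q⇒¬p⊂q⇒∣p∣≡∣q∣ : ∀ {m} {p q : Subset m} → p ⊆ q → ¬ p ⊂ q → ∣ p ∣ ≡ ∣ q ∣
p⊆q⇒¬p⊂q⇒∣p∣≡∣q∣ {p = []}          {[]}          _   _   = refl
p⊆q⇒¬p⊂q⇒∣p∣≡∣q∣ {p = outside ∷ p} {outside ∷ q} p⊆q p⊄q = p⊆q⇒¬p⊂q⇒∣p∣≡∣q∣ (drop-∷-⊆ p⊆q) (p⊄q ∘ out⊂)
p⊆q⇒¬p⊂q⇒∣p∣≡∣q∣ {p = outside ∷ p} {inside  ∷ q} p⊆q p⊄q = contradiction (out⊂in (drop-∷-⊆ p⊆q)) p⊄q
p⊆q⇒¬p⊂q⇒∣p∣≡∣q∣ {p = inside  ∷ p} {outside ∷ q} p⊆q _   = ⊥-elim (inside∷⊈outside∷ p⊆q)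
p⊆q⇒¬p⊂q⇒∣p∣≡∣q∣ {p = inside  ∷ p} {inside  ∷ q} p⊆q p⊄q = cong suc (p⊆q⇒¬p⊂q⇒∣p∣≡∣q∣ (drop-∷-⊆ p⊆q) (p⊄q ∘ s⊂s))

⊆-decode : ∀ {τ σ : Subset (dbl n)} → τ ⊆ σ → T (admissible σ) → T (admissible τ) × T (decode τ ⊑ᵇ decode σ)
⊆-decode {zero}  {[]}                  {[]}                  _   _ = _ , _
⊆-decode {suc n} {_ ∷ _ ∷ τ}           {true ∷ true ∷ σ}     _   ()
⊆-decode {suc n} {true ∷ false ∷ τ}    {true ∷ false ∷ σ}    τ⊆σ a = ⊆-decode (drop-∷-⊆ (drop-∷-⊆ τ⊆σ)) a
⊆-decode {suc n} {false ∷ false ∷ τ}   {true ∷ false ∷ σ}    τ⊆σ a = ⊆-decode (drop-∷-⊆ (drop-∷-⊆ τ⊆σ)) a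
⊆-decode {suc n} {false ∷ true ∷ τ}    {false ∷ true ∷ σ}    τ⊆σ a = ⊆-decode (drop-∷-⊆ (drop-∷-⊆ τ⊆σ)) a
⊆-decode {suc n} {false ∷ false ∷ τ}   {false ∷ true ∷ σ}    τ⊆σ a = ⊆-decode (drop-∷-⊆ (drop-∷-⊆ τ⊆σ)) a
⊆-decode {suc n} {false ∷ false ∷ τ}   {false ∷ false ∷ σ}   τ⊆σ a = ⊆-decode (drop-∷-⊆ (drop-∷-⊆ τ⊆σ)) a
⊆-decode {suc n} {true ∷ _ ∷ τ}        {false ∷ _ ∷ σ}       τ⊆σ _ = ⊥-elim (inside∷⊈outside∷ τ⊆σ)
⊆-decode {suc n} {_ ∷ true ∷ τ}        {_ ∷ false ∷ σ}       τ⊆σ _ = ⊥-elim (inside∷⊈outside∷ (drop-∷-⊆ τ⊆σ))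

⊆-encode : ∀ {σ : Subset (dbl n)} (U : AdS n) → T (admissible σ) → T (decode σ ⊑ᵇ U) → σ ⊆ encode U
⊆-encode {zero}  {[]}                  []        _ _ = ⊆-refl
⊆-encode {suc n} {true ∷ true ∷ σ}     _         () _
⊆-encode {suc n} {true ∷ false ∷ σ}    (pos ∷ U) a σ⊑U = s⊆s (s⊆s (⊆-encode U a σ⊑U))
⊆-encode {suc n} {false ∷ true ∷ σ}    (neg ∷ U) a σ⊑U = s⊆s (s⊆s (⊆-encode U a σ⊑U))
⊆-encode {suc n} {false ∷ false ∷ σ}   (out ∷ U) a σ⊑U = out⊆ (out⊆ (⊆-encode U a σ⊑U))
⊆-encode {suc n} {false ∷ false ∷ σ}   (pos ∷ U) a σ⊑U = out⊆ (out⊆ (⊆-encode U a σ⊑U))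
⊆-encode {suc n} {false ∷ false ∷ σ}   (neg ∷ U) a σ⊑U = out⊆ (out⊆ (⊆-encode U a σ⊑U))
⊆-encode {suc n} {true ∷ false ∷ σ}    (out ∷ U) _ ()
⊆-encode {suc n} {true ∷ false ∷ σ}    (neg ∷ U) _ ()
⊆-encode {suc n} {false ∷ true ∷ σ}    (out ∷ U) _ ()
⊆-encode {suc n} {false ∷ true ∷ σ}    (pos ∷ U) _ ()

count-admissible : (Q : AdS n → Bool) →
  count (λ σ → admissible σ ∧ Q (decode σ)) (allSubsets (dbl n)) ≡ count Q (allAdS n)
count-admissible {zero}  Q = refl
count-admissible {suc n} Q = begin
  count P (allTransversals (suc (suc (dbl n))))
    ≡⟨ count-allTransversals P ⟩
  count (λ σ → P (true ∷ σ)) (allTransversals (suc (dbl n))) + count (λ σ → P (false ∷ σ)) (allTransversals (suc (dbl n)))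
    ≡⟨ cong₂ _+_ (count-allTransversals (λ σ → P (true ∷ σ))) (count-allTransversals (λ σ → P (false ∷ σ))) ⟩
  (count (λ σ → P (true ∷ true ∷ σ)) σs + count (λ σ → P (true ∷ false ∷ σ)) σs)
    + (count (λ σ → P (false ∷ true ∷ σ)) σs + count (λ σ → P (false ∷ false ∷ σ)) σs)
    ≡⟨ cong₂ _+_ (cong₂ _+_ (count-none σs λ _ ()) (count-admissible (λ S → Q (pos ∷ S))))
                 (cong₂ _+_ (count-admissible (λ S → Q (neg ∷ S))) (count-admissible (λ S → Q (out ∷ S)))) ⟩
  #pos + (#neg + #out)
    ≡⟨ +-assoc #pos #neg #out ⟨
  #pos + #neg + #out
    ≡⟨ +-comm (#pos + #neg) #out ⟩
  #out + (#pos + #neg)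
    ≡⟨ count-allAdS Q ⟨
  count Q (allAdS (suc n)) ∎
  where
  open ≡-Reasoning
  P : Subset (dbl (suc n)) → Bool
  P σ = admissible σ ∧ Q (decode σ)
  σs = allTransversals (dbl n)
  #out = count (λ S → Q (out ∷ S)) (allAdS n)
  #pos = count (λ S → Q (pos ∷ S)) (allAdS n)
  #neg = count (λ S → Q (neg ∷ S)) (allAdS n)

module PureFamily {n : ℕ} (Φ : AdS n → Bool)
    (Φ-down    : ∀ {R S} → T (R ⊑ᵇ S) → T (Φ S) → T (Φ R))
    (Φ-extends : ∀ {S} → T (Φ S) → Σ (AdS n) λ U → T (Φ U) × size U ≡ n × T (S ⊑ᵇ U))
  where

  isFace : ℕ → AdS n → Bool
  isFace k S = Φ S ∧ (size S ≡ᵇ k)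

  faceCount : ℕ → ℕ
  faceCount k = count (isFace k) (allAdS n)

  faceCount-beyond : n < k → faceCount k ≡ 0
  faceCount-beyond {k} n<k = count-none (allAdS n) λ S face →
    <⇒≢ (≤-<-trans (size≤n S) n<k) (≡ᵇ⇒≡ (size S) k (proj₂ (to T-∧ face)))

  faceCount-double-counting : i ≤ j → faceCount i * ((n ∸ i) C (j ∸ i)) ≤ faceCount j * (j C i)
  faceCount-double-counting {i} {j} i≤j =
    double-counting (isFace i) (isFace j) _⊑ᵇ_ (allAdS n) (allAdS n) many-cofaces few-faces
    where
    open ≤-Reasoning
    many-cofaces : ∀ R → T (isFace i R) → (n ∸ i) C (j ∸ i) ≤ count (λ S → isFace j S ∧ R ⊑ᵇ S) (allAdS n)
    many-cofaces R R-face with to T-∧ R-face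
    ... | ΦR , |R|≡ᵇi with Φ-extends ΦR
    ... | U , ΦU , |U|≡n , R⊑U = begin
      (n ∸ i) C (j ∸ i)                        ≡⟨ cong (_C (j ∸ i)) gap≡n∸i ⟨
      gap R U C (j ∸ i)                        ≡⟨ count-between R U (j ∸ i) R⊑U ⟨
      count (between R U (j ∸ i)) (allAdS n)  ≤⟨ count-mono (allAdS n) between⇒coface ⟩
      count (λ S → isFace j S ∧ R ⊑ᵇ S) (allAdS n) ∎
      where
      |R|≡i : size R ≡ i
      |R|≡i = ≡ᵇ⇒≡ (size R) i |R|≡ᵇi
      gap≡n∸i : gap R U ≡ n ∸ i
      gap≡n∸i = trans (sym (m+n∸m≡n i (gap R U)))
                      (cong (_∸ i) (trans (cong (_+ gap R U) (sym |R|≡i)) (trans (sym (size-⊑ᵇ R U R⊑U)) |U|≡n)))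
      between⇒coface : ∀ S → T (between R U (j ∸ i) S) → T (isFace j S ∧ R ⊑ᵇ S)
      between⇒coface S between-S with to T-∧ between-S
      ... | R⊑S , rest with to T-∧ rest
      ... | S⊑U , gap≡ᵇ = from T-∧ (from T-∧ (Φ-down S⊑U ΦU , ≡⇒≡ᵇ (size S) j |S|≡j) , R⊑S)
        where
        |S|≡j : size S ≡ j
        |S|≡j = trans (size-⊑ᵇ R S R⊑S) (trans (cong₂ _+_ |R|≡i (≡ᵇ⇒≡ (gap R S) (j ∸ i) gap≡ᵇ)) (m+[n∸m]≡n i≤j))
    few-faces : ∀ S → T (isFace j S) → count (λ R → isFace i R ∧ R ⊑ᵇ S) (allAdS n) ≤ j C i
    few-faces S S-face = begin
      count (λ R → isFace i R ∧ R ⊑ᵇ S) (allAdS n) ≤⟨ count-mono (allAdS n) face⇒between ⟩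
      count (between ∅ S i) (allAdS n)            ≡⟨ count-between ∅ S i (∅⊑ᵇ S) ⟩
      gap ∅ S C i                                 ≡⟨ cong (_C i) (trans (gap-∅ S) |S|≡j) ⟩
      j C i                                       ∎
      where
      |S|≡j : size S ≡ j
      |S|≡j = ≡ᵇ⇒≡ (size S) j (proj₂ (to T-∧ S-face))
      face⇒between : ∀ R → T (isFace i R ∧ R ⊑ᵇ S) → T (between ∅ S i R)
      face⇒between R R-face with to T-∧ R-face
      ... | R-face , R⊑S = from T-∧ (∅⊑ᵇ R , from T-∧ (R⊑S ,
        ≡⇒≡ᵇ (gap ∅ R) i (trans (gap-∅ R) (≡ᵇ⇒≡ (size R) i (proj₂ (to T-∧ R-face))))))

  faceCount-mono : i ≤ j → j ≤ n ∸ i → faceCount i ≤ faceCount j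
  faceCount-mono {i} {j} i≤j j≤n∸i =
    *-cancelʳ-≤ (faceCount i) (faceCount j) c {{>-nonZero c>0}} (begin
      faceCount i * c        ≤⟨ faceCount-double-counting i≤j ⟩
      faceCount j * (j C i)  ≤⟨ *-monoʳ-≤ (faceCount j) jCi≤c ⟩
      faceCount j * c        ∎)
    where
    open ≤-Reasoning
    c : ℕ
    c = (n ∸ i) C (j ∸ i)
    c>0 : 0 < c
    c>0 = C-positive (∸-monoˡ-≤ i (≤-trans j≤n∸i (m∸n≤m n i)))
    jCi≤c : j C i ≤ c
    jCi≤c = subst (_≤ c) (sym (nCk≡nC[n∸k] i≤j)) (C-monoˡ (j ∸ i) j≤n∸i)

  isSimplex : Subset (dbl n) → Bool
  isSimplex σ = admissible σ ∧ Φ (decode σ)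

  isSimplex-down : ∀ {σ τ} → τ ⊆ σ → T (isSimplex σ) → T (isSimplex τ)
  isSimplex-down τ⊆σ σ-simplex with to T-∧ σ-simplex
  ... | σ-adm , Φσ with ⊆-decode τ⊆σ σ-adm
  ... | τ-adm , τ⊑σ = from T-∧ (τ-adm , Φ-down τ⊑σ Φσ)

  complex : SimplicialComplex (dbl n)
  complex = record
    { face       = isSimplex
    ; downClosed = λ σ τ σ-face τ⊆σ → to T-≡ (isSimplex-down τ⊆σ (from T-≡ σ-face))
    }

  facet-size : ∀ {σ} → IsFacet complex σ → ∣ σ ∣ ≡ n
  facet-size {σ} (σ-face , maximal) with to T-∧ (from T-≡ σ-face)
  ... | σ-adm , Φσ with Φ-extends Φσ
  ... | U , ΦU , |U|≡n , σ⊑U =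
    trans (p⊆q⇒¬p⊂q⇒∣p∣≡∣q∣ σ⊆U (maximal (encode U) U-face)) (trans (∣encode∣ U) |U|≡n)
    where
    σ⊆U : σ ⊆ encode U
    σ⊆U = ⊆-encode U σ-adm σ⊑U
    U-face : isSimplex (encode U) ≡ true
    U-face = to T-≡ (from T-∧ (admissible-encode U , subst (T ∘ Φ) (sym (decode-encode U)) ΦU))

  complex-pure : IsPure complex
  complex-pure σ τ σ-facet τ-facet = trans (facet-size σ-facet) (sym (facet-size τ-facet))

  fvec-complex : ∀ k → fvec complex k ≡ faceCount k
  fvec-complex k = begin
    fvec complex k                                                ≡⟨ length-filter≡count _ (allSubsets (dbl n)) ⟩
    count (λ σ → isSimplex σ ∧ (∣ σ ∣ ≡ᵇ k)) (allSubsets (dbl n))  ≡⟨ count-cong (allSubsets (dbl n)) decode-size ⟩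
    count (λ σ → admissible σ ∧ isFace k (decode σ)) (allSubsets (dbl n)) ≡⟨ count-admissible (isFace k) ⟩
    faceCount k                                                   ∎
    where
    open ≡-Reasoning
    decode-size : ∀ σ → isSimplex σ ∧ (∣ σ ∣ ≡ᵇ k) ≡ admissible σ ∧ isFace k (decode σ)
    decode-size σ with admissible σ in adm
    ... | false = refl
    ... | true  = cong (λ m → Φ (decode σ) ∧ (m ≡ᵇ k)) (∣σ∣≡size-decode σ (from T-≡ adm))

module DeltaMatroidComplex {n : ℕ} (D : DeltaMatroid n) where

  open PureFamily (independent D) (λ {R} {S} → independent-down D {R} {S}) (λ {S} → independent-extends D {S}) public

  aCoeff≡faceCount : k ≤ n → aCoeff D k ≡ faceCount k
  -- does (m ≟ n) reduces to m ≡ᵇ n.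
  aCoeff≡faceCount {k} k≤n =
    trans (length-filter≡count _ (allAdS n)) (count-cong (allAdS n) λ S →
      cong₂ _∧_ (vExpZero≡independent D S)
                (does-⇔ (mk⇔ (∸-cancelˡ-≡ (size≤n S) k≤n) (cong (n ∸_))) (n ∸ size S ≟ n ∸ k) (size S ≟ k)))

  aCoeff-mono : i ≤ j → j ≤ n ∸ i → aCoeff D i ≤ aCoeff D j
  aCoeff-mono {i} {j} i≤j j≤n∸i =
    subst₂ _≤_ (sym (aCoeff≡faceCount (≤-trans i≤j j≤n))) (sym (aCoeff≡faceCount j≤n)) (faceCount-mono i≤j j≤n∸i)
    where
    j≤n : j ≤ n
    j≤n = ≤-trans j≤n∸i (m∸n≤m n i)

2*i≤n⇒i≤n∸i : 2 * i ≤ n → i ≤ n ∸ i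
2*i≤n⇒i≤n∸i {i} {n} 2i≤n = m+n≤o⇒m≤o∸n i (subst (_≤ n) (cong (_+_ i) (+-identityʳ i)) 2i≤n)

i<[n+1]/2⇒1+i≤n∸i : i < (n + 1) / 2 → suc i ≤ n ∸ i
i<[n+1]/2⇒1+i≤n∸i {i} {n} i<½ = m+n≤o⇒m≤o∸n (suc i) (≤-pred (begin
  suc (suc i) + i      ≡⟨ cong (suc ∘ suc) (trans (cong (_+_ i) (sym (+-identityʳ i))) (*-comm 2 i)) ⟩
  suc i * 2            ≤⟨ *-monoˡ-≤ 2 i<½ ⟩
  (n + 1) / 2 * 2      ≤⟨ m/n*n≤m (n + 1) 2 ⟩
  n + 1                ≡⟨ +-comm n 1 ⟩
  suc n                ∎))
  where open ≤-Reasoning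

corollary3p5 : (n : ℕ) (D : DeltaMatroid n) →
    (Σ ℕ λ m → Σ (SimplicialComplex m) λ Δ → IsPure Δ × IsFVectorOf n (aCoeff D) Δ)
    × (∀ i → 2 * i ≤ n → aCoeff D i ≤ aCoeff D (n ∸ i))
    × (∀ i → i < (n + 1) / 2 → aCoeff D i ≤ aCoeff D (suc i))
corollary3p5 n D =
    ( dbl n , complex , complex-pure
    , (λ k k≤n → trans (fvec-complex k) (sym (aCoeff≡faceCount k≤n)))
    , (λ k n<k → trans (fvec-complex k) (faceCount-beyond n<k)) )
  , (λ i 2i≤n → aCoeff-mono (2*i≤n⇒i≤n∸i {i} 2i≤n) ≤-refl)
  , (λ i i<½ → aCoeff-mono (n≤1+n i) (i<[n+1]/2⇒1+i≤n∸i {i} i<½))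
  where open DeltaMatroidComplex D
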